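{- Let $A$ be a set of integers. Then \[C(A)\geq\left\lfloor\frac{R_2(A)^{1/2}}{4}\right\rfloor.\] Consequently, if $\{1,\ldots,N\}=A_1\cup\cdots\cup A_r$ is a partition of $\{1,\ldots,N\}$ (with $r,N$ positive integers) and $N\geq 3^{r^2+r}$, then \[\max\{C(A_i):1\leq i\leq r\}\geq \left\lfloor\frac{N^{1/(2r)}}{4\cdot 3^{r/2}}\right\rfloor.\] Similarly, if $\delta\in(0,1]$, $s=\lceil \log_2(1/(4\delta))\rceil$, $N\geq\max\{(2s)^s,3^{73s}\}$ is a positive integer and $A\subseteq\{1,\ldots,N\}$ satisfies $|A|\geq\delta N$, then \[C(A-A)\geq \left\lfloor\frac{N^{1/(16s+16)}}{4\cdot3^8}\right\rfloor.\]
   Context: $A-A=\{a-a':a,a'\in A\}$. A finite increasing sequence $a_1<\cdots<a_n$ is strictly convex if the sequence of first differences $a_{i+1}-a_i$ is strictly monotone; $C(B)$ denotes the length of the longest strictly convex sequence contained in $B$. For $L\geq 1$, a finite increasing sequence of real numbers $a_1<\cdots<a_n$ is called $L$-regular if there is a positive real number $X$ such that $X\leq a_{i+1}-a_i\leq LX$ for all $i=1,\ldots,n-1$. For a set $B$ of real numbers, $R_L(B)=\max\{|B'|:B'\subseteq B,\ B'\text{ is }L\text{ -regular}\}$.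
   Formalization: The density parameter δ in the third part ranges only over the rationals in (0,1]. -}

module Defs where

open import Data.Nat as ℕ using (ℕ; zero; suc)
open import Data.Integer as ℤ using (ℤ; +_)
open import Data.Rational as ℚ using (ℚ)
open import Data.Fin using (Fin; toℕ; inject₁) renaming (suc to fsuc)
open import Data.Fin.Subset using (Subset; _∈_)
open import Data.Product using (Σ; ∃; _×_)
open import Data.Sum using (_⊎_)
open import Data.Unit using (⊤)
open import Relation.Binary.PropositionalEquality using (_≡_)

toℚ : ℤ → ℚ
toℚ z = z ℚ./ 1

Seq : ℕ → Set
Seq n = Fin n → ℤ

diff : {n : ℕ} → Seq (suc n) → Fin n → ℤ
diff a i = a (fsuc i) ℤ.- a (inject₁ i)

StrictlyIncreasing : {n : ℕ} → Seq n → Set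
StrictlyIncreasing {zero} a = ⊤
StrictlyIncreasing {suc n} a = (i : Fin n) → a (inject₁ i) ℤ.< a (fsuc i)

StrictlyMonotone : {m : ℕ} → (Fin m → ℤ) → Set
StrictlyMonotone {zero} d = ⊤
StrictlyMonotone {suc m} d =
  ((i : Fin m) → d (inject₁ i) ℤ.< d (fsuc i)) ⊎ ((i : Fin m) → d (fsuc i) ℤ.< d (inject₁ i))

StrictlyConvex : {n : ℕ} → Seq n → Set
StrictlyConvex {zero} a = StrictlyIncreasing a
StrictlyConvex {suc n} a = StrictlyIncreasing a × StrictlyMonotone (diff a)

Regular : ℚ → {n : ℕ} → Seq n → Set
Regular L {zero} a = StrictlyIncreasing a
Regular L {suc n} a = StrictlyIncreasing a ×
  ∃ λ (X : ℚ) → (ℚ.0ℚ ℚ.< X) ×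
    ((i : Fin n) → (X ℚ.≤ toℚ (diff a i)) × (toℚ (diff a i) ℚ.≤ L ℚ.* X))

InSet : (B : ℤ → Set) → {n : ℕ} → Seq n → Set
InSet B a = ∀ i → B (a i)

-- "C(B) ≥ k": B contains a strictly convex sequence of length at least k
CAtLeast : (B : ℤ → Set) → ℕ → Set
CAtLeast B k = Σ ℕ λ n → (k ℕ.≤ n) × Σ (Seq n) λ a → InSet B a × StrictlyConvex a

-- "R_L(B) ≥ m": B contains an L-regular subset with at least m elements
RAtLeast : ℚ → (B : ℤ → Set) → ℕ → Set
RAtLeast L B m = Σ ℕ λ n → (m ℕ.≤ n) × Σ (Seq n) λ a → InSet B a × Regular L a

-- a subset of {1,…,N}, given as Subset N with j ↦ j+1, viewed as a set of integers
toSet : {N : ℕ} → Subset N → ℤ → Set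
toSet {N} S z = ∃ λ (j : Fin N) → (j ∈ S) × (z ≡ + suc (toℕ j))

DiffSet : (ℤ → Set) → ℤ → Set
DiffSet B z = ∃ λ x → ∃ λ y → B x × B y × (z ≡ x ℤ.- y)

IsPartition : {r N : ℕ} → (Fin r → Subset N) → Set
IsPartition {r} {N} P = (j : Fin N) → ∃ λ (i : Fin r) → (j ∈ P i) × ((i' : Fin r) → j ∈ P i' → i' ≡ i)

-- Put Sᵢ = 3L·i(i+1)/2. Choosing one point in each window [Sᵢ, Sᵢ + L) gives a strictly
-- convex sequence: consecutive gaps lie within L of 3L(i+1), so they increase.
-- (1) In a 2-regular sequence of n ≥ 16k² terms all gaps lie between d/2 and 2d, d the
-- first gap. The sequence advances by at most 2d per step and by at least nd/2 in total,
-- so it meets each of the first k windows at scale L = 2d.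
-- (2) With t colours on an interval of length (3k²)^t, either the first colour meets all
-- k windows at scale (3k²)^(t-1), or one of these windows avoids it and is coloured by
-- the remaining t - 1 colours.
-- (3) If A - A misses the window [u, u + 3h), then of two blocks of length h at distance
-- about u + 2h at most one meets A. Averaging over such pairs, some block of length
-- h = ⌊M/Z⌋, Z = 100k², is 3/2 times denser than the current interval of length M.
-- Densities are at most 1, so after boundedly many such steps A - A meets all k windows
-- at some scale.

module Submission where

open import Defs
open import Data.Bool using (true; false; if_then_else_)
open import Data.Empty using (⊥-elim)
open import Data.Fin as Fin using (Fin; toℕ; inject₁; fromℕ<)
open import Data.Fin.Properties using (toℕ-inject₁; toℕ<n; toℕ-fromℕ<; any?)
open import Data.Fin.Subset using (Subset; ∣_∣)
open import Data.Fin.Subset.Properties using (_∈?_)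
open import Data.Vec using ([]; _∷_; here; there)
open import Data.Integer as ℤ using (ℤ; +_; -[1+_]; +<+)
import Data.Integer.Properties as ℤ
import Data.Integer.Tactic.RingSolver as ℤ-Solver
open import Data.Nat as ℕ using (ℕ; zero; suc; _+_; _*_; _∸_; _^_; _≤_; _<_; _⊔_; z≤n; s≤s; z<s; NonZero)
open import Data.Nat.Properties
open import Data.Nat.DivMod using (_/_; _%_; m≡m%n+[m/n]*n; m%n<n; m/n*n≤m; m*n/n≡m; /-monoˡ-≤)
open import Data.Nat.Tactic.RingSolver using (solve-∀)
open import Data.Nat.Coprimality using (Coprime; 1-coprimeTo)
import Data.Nat.Coprimality as Coprime
open import Data.Product using (Σ; ∃; ∃-syntax; _×_; _,_; proj₁; proj₂)
open import Data.Rational as ℚ using (ℚ; 0ℚ; 1ℚ; mkℚ; ↥_; ↧_)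
import Data.Rational.Properties as ℚ
open import Data.Sum using (_⊎_; inj₁; inj₂)
open import Data.Unit using (tt)
open import Function using (_∘_)
open import Function.Bundles using (_⇔_; mk⇔)
open import Relation.Nullary using (yes; no; ¬_; ¬?; does)
open import Relation.Nullary.Decidable using (_×-dec_; decidable-stable; toWitness; does-⇔; dec-true; dec-false)
open import Relation.Unary using (Decidable)
open import Relation.Binary.PropositionalEquality

toℚ≡mkℚ : ∀ z → Σ (Coprime ℤ.∣ z ∣ 1) λ c → toℚ z ≡ mkℚ z 0 c
toℚ≡mkℚ (+ n)    = c , ℚ.normalize-coprime c
  where c = Coprime.sym (1-coprimeTo n)
toℚ≡mkℚ -[1+ n ] = c , cong ℚ.-_ (ℚ.normalize-coprime c)
  where c = Coprime.sym (1-coprimeTo (suc n))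

↥toℚ*↧toℚ : ∀ a b → ↥ toℚ a ℤ.* ↧ toℚ b ≡ a
↥toℚ*↧toℚ a b with toℚ≡mkℚ a | toℚ≡mkℚ b
... | _ , eqa | _ , eqb rewrite eqa | eqb = ℤ.*-identityʳ a

toℚ-cancel-≤ : ∀ {a b} → toℚ a ℚ.≤ toℚ b → a ℤ.≤ b
toℚ-cancel-≤ {a} {b} p = subst₂ ℤ._≤_ (↥toℚ*↧toℚ a b) (↥toℚ*↧toℚ b a) (ℚ.drop-*≤* p)

toℚ-* : ∀ a b → toℚ a ℚ.* toℚ b ≡ toℚ (a ℤ.* b)
toℚ-* a b with toℚ≡mkℚ a | toℚ≡mkℚ b
... | _ , eqa | _ , eqb rewrite eqa | eqb = refl

toℚ-nonNegative : ∀ n → ℚ.NonNegative (toℚ (+ n))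
toℚ-nonNegative n with toℚ≡mkℚ (+ n)
... | _ , eq rewrite eq = _

all-or-counterexample : ∀ {p} {P : ℕ → Set p} → Decidable P → ∀ k →
                        (∀ i → i < k → P i) ⊎ ∃[ i ] i < k × ¬ P i
all-or-counterexample P? k with anyUpTo? (¬? ∘ P?) k
... | yes counterexample = inj₂ counterexample
... | no  none           = inj₁ λ i i<k → decidable-stable (P? i) (λ ¬Pi → none (i , i<k , ¬Pi))

bounded-choice : ∀ {k} {P : ℕ → ℕ → Set} → (∀ i → i < k → ∃ (P i)) →
                 ∃[ g ] ∀ i → i < k → P i (g i)
bounded-choice {k} {P} h = g , spec
  where
  g : ℕ → ℕ
  g i with i ℕ.<? k
  ... | yes i<k = proj₁ (h i i<k)
  ... | no  _   = 0
  spec : ∀ i → i < k → P i (g i)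
  spec i i<k with i ℕ.<? k
  ... | yes i<k′ = proj₂ (h i i<k′)
  ... | no  i≮k  = ⊥-elim (i≮k i<k)

-- Convex sequences through quadratically spaced windows

CAtLeast-zero : ∀ B → CAtLeast B 0
CAtLeast-zero B = 0 , z≤n , (λ ()) , (λ ()) , tt

midpoint⇒gap< : ∀ a b c → b ℤ.+ b ℤ.< a ℤ.+ c → b ℤ.- a ℤ.< c ℤ.- b
midpoint⇒gap< a b c mid =
  subst₂ ℤ._<_ (left a b) (right a b c) (ℤ.+-monoˡ-< (ℤ.- (a ℤ.+ b)) mid)
  where
  left : ∀ a b → (b ℤ.+ b) ℤ.- (a ℤ.+ b) ≡ b ℤ.- a
  left = ℤ-Solver.solve-∀
  right : ∀ a b c → (a ℤ.+ c) ℤ.- (a ℤ.+ b) ≡ c ℤ.- b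
  right = ℤ-Solver.solve-∀

strictlyConvex-tabulate : ∀ (f : ℕ → ℤ) k →
  (∀ m → suc m < k → f m ℤ.< f (suc m)) →
  (∀ m → 2 + m < k → f (suc m) ℤ.+ f (suc m) ℤ.< f m ℤ.+ f (2 + m)) →
  StrictlyConvex (λ (j : Fin k) → f (toℕ j))
strictlyConvex-tabulate f zero          _   _   = tt
strictlyConvex-tabulate f (suc zero)    _   _   = (λ ()) , tt
strictlyConvex-tabulate f (suc (suc n)) inc mid = increasing , inj₁ gaps-increasing
  where
  increasing : (i : Fin (suc n)) → f (toℕ (inject₁ i)) ℤ.< f (suc (toℕ i))
  increasing i rewrite toℕ-inject₁ i = inc (toℕ i) (s≤s (toℕ<n i))
  gaps-increasing : (i : Fin n) →
    f (suc (toℕ (inject₁ i))) ℤ.- f (toℕ (inject₁ (inject₁ i))) ℤ.<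
    f (2 + toℕ i) ℤ.- f (suc (toℕ (inject₁ i)))
  gaps-increasing i rewrite toℕ-inject₁ (inject₁ i) | toℕ-inject₁ i =
    midpoint⇒gap< (f (toℕ i)) (f (suc (toℕ i))) (f (2 + toℕ i)) (mid (toℕ i) (s≤s (s≤s (toℕ<n i))))

windowStart : ℕ → ℕ → ℕ
windowStart L zero    = 0
windowStart L (suc i) = windowStart L i + 3 * L * suc i

InWindow : ℕ → ℕ → ℕ → Set
InWindow L i v = windowStart L i ≤ v × v < windowStart L i + L

windowEnd≤ : ∀ L {i k} → i < k → windowStart L i + L ≤ 3 * (k * k) * L
windowEnd≤ L {i} {k} i<k =
  ≤-trans (end≤ i) (≤-trans (*-monoʳ-≤ (3 * L) (*-mono-≤ i<k i<k)) (≤-reflexive (reorder L (k * k))))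
  where
  reorder : ∀ L x → 3 * L * x ≡ 3 * x * L
  reorder = solve-∀
  end≤ : ∀ i → windowStart L i + L ≤ 3 * L * (suc i * suc i)
  end≤ zero    = subst (L ≤_) (solve L) (m≤m+n L (2 * L))
    where
    solve : ∀ L → L + 2 * L ≡ 3 * L * 1
    solve = solve-∀
  end≤ (suc i) = begin
    windowStart L i + 3 * L * suc i + L                       ≡⟨ swap (windowStart L i) (3 * L * suc i) L ⟩
    windowStart L i + L + 3 * L * suc i                       ≤⟨ +-monoˡ-≤ (3 * L * suc i) (end≤ i) ⟩
    3 * L * (suc i * suc i) + 3 * L * suc i                   ≤⟨ m≤m+n _ (3 * L * (2 + i)) ⟩
    3 * L * (suc i * suc i) + 3 * L * suc i + 3 * L * (2 + i) ≡⟨ square-step L i ⟩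
    3 * L * ((2 + i) * (2 + i))                               ∎
    where
    open ≤-Reasoning
    swap : ∀ a b c → a + b + c ≡ a + c + b
    swap = solve-∀
    square-step : ∀ L i → 3 * L * (suc i * suc i) + 3 * L * suc i + 3 * L * (2 + i) ≡ 3 * L * ((2 + i) * (2 + i))
    square-step = solve-∀

inWindow-increasing : ∀ {L m v w} → InWindow L m v → InWindow L (suc m) w → v < w
inWindow-increasing {L} {m} {v} {w} (_ , v<end) (start≤w , _) = begin-strict
  v                                   <⟨ v<end ⟩
  windowStart L m + L                 ≤⟨ +-monoʳ-≤ (windowStart L m) (subst (L ≤_) (spread L m) (m≤m+n L _)) ⟩
  windowStart L m + 3 * L * suc m     ≤⟨ start≤w ⟩
  w                                   ∎
  where
  open ≤-Reasoning
  spread : ∀ L m → L + (2 * L + 3 * L * m) ≡ 3 * L * suc m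
  spread = solve-∀

inWindow-midpoint : ∀ {L m u v w} → 1 ≤ L →
  InWindow L m u → InWindow L (suc m) v → InWindow L (2 + m) w → v + v < u + w
inWindow-midpoint {L} {m} {u} {v} {w} 1≤L (start≤u , _) (_ , v<end) (start≤w , _) = begin-strict
  v + v                               <⟨ +-mono-< v<end v<end ⟩
  end + end                           <⟨ m<m+n (end + end) 1≤L ⟩
  end + end + L                       ≡⟨ regroup (windowStart L m) L m ⟩
  windowStart L m + windowStart L (2 + m) ≤⟨ +-mono-≤ start≤u start≤w ⟩
  u + w                               ∎
  where
  open ≤-Reasoning
  end = windowStart L (suc m) + L
  regroup : ∀ P L m → (P + 3 * L * suc m + L) + (P + 3 * L * suc m + L) + L ≡
                      P + (P + 3 * L * suc m + 3 * L * (2 + m))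
  regroup = solve-∀

windows⇒CAtLeast : ∀ (B : ℤ → Set) z L k → 1 ≤ L →
  (∀ i → i < k → ∃[ v ] InWindow L i v × B (z ℤ.+ + v)) → CAtLeast B k
windows⇒CAtLeast B z L k 1≤L hits =
  k , ≤-refl , (λ j → f (toℕ j)) , (λ j → proj₂ (spec (toℕ j) (toℕ<n j))) ,
  strictlyConvex-tabulate f k increasing midpoint
  where
  choice = bounded-choice hits
  g = proj₁ choice
  spec = proj₂ choice
  f : ℕ → ℤ
  f m = z ℤ.+ + g m
  window : ∀ {m} → m < k → InWindow L m (g m)
  window {m} m<k = proj₁ (spec m m<k)
  increasing : ∀ m → suc m < k → f m ℤ.< f (suc m)
  increasing m 1+m<k =
    ℤ.+-monoʳ-< z (+<+ (inWindow-increasing {L} {m} (window (<-trans (n<1+n m) 1+m<k)) (window 1+m<k)))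
  sum-shift : ∀ a b → (z ℤ.+ z) ℤ.+ + (a + b) ≡ (z ℤ.+ + a) ℤ.+ (z ℤ.+ + b)
  sum-shift a b = trans (cong (λ x → (z ℤ.+ z) ℤ.+ x) (ℤ.pos-+ a b)) (regroup z (+ a) (+ b))
    where
    regroup : ∀ z x y → (z ℤ.+ z) ℤ.+ (x ℤ.+ y) ≡ (z ℤ.+ x) ℤ.+ (z ℤ.+ y)
    regroup = ℤ-Solver.solve-∀
  midpoint : ∀ m → 2 + m < k → f (suc m) ℤ.+ f (suc m) ℤ.< f m ℤ.+ f (2 + m)
  midpoint m 2+m<k = subst₂ ℤ._<_ (sum-shift _ _) (sum-shift _ _)
    (ℤ.+-monoʳ-< (z ℤ.+ z) (+<+ (inWindow-midpoint {L} {m} 1≤L (window m<k) (window 1+m<k) (window 2+m<k))))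
    where
    1+m<k = <-trans (n<1+n (suc m)) 2+m<k
    m<k = <-trans (n<1+n m) 1+m<k

-- Regular sequences

i-j≤k⇒i≤j+k : ∀ i j k → i ℤ.- j ℤ.≤ k → i ℤ.≤ j ℤ.+ k
i-j≤k⇒i≤j+k i j k i-j≤k = subst (ℤ._≤ j ℤ.+ k) (cancel i j) (ℤ.+-monoʳ-≤ j i-j≤k)
  where
  cancel : ∀ i j → j ℤ.+ (i ℤ.- j) ≡ i
  cancel = ℤ-Solver.solve-∀

i+i≤j+j⇒i≤j : ∀ {i j} → i ℤ.+ i ℤ.≤ j ℤ.+ j → i ℤ.≤ j
i+i≤j+j⇒i≤j {i} {j} i+i≤j+j with i ℤ.≤? j
... | yes i≤j = i≤j
... | no  i≰j = ⊥-elim (ℤ.<⇒≱ (ℤ.+-mono-< j<i j<i) i+i≤j+j)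
  where j<i = ℤ.≰⇒> i≰j

window-offset : ∀ z p L w → z ℤ.+ + p ℤ.≤ w → w ℤ.< z ℤ.+ + (p + L) →
                ∃[ v ] w ≡ z ℤ.+ + v × p ≤ v × v < p + L
window-offset z p L w start≤w w<end =
  ℤ.∣ w ℤ.- z ∣ , trans (sym (cancel z w)) (cong (ℤ._+_ z) (sym +∣w-z∣≡w-z)) ,
  ℤ.drop‿+≤+ (subst (+ p ℤ.≤_) (sym +∣w-z∣≡w-z) p≤w-z) ,
  ℤ.drop‿+<+ (subst (ℤ._< + (p + L)) (sym +∣w-z∣≡w-z) w-z<p+L)
  where
  cancel : ∀ z w → z ℤ.+ (w ℤ.- z) ≡ w
  cancel = ℤ-Solver.solve-∀
  shift : ∀ z x → (z ℤ.+ x) ℤ.- z ≡ x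
  shift = ℤ-Solver.solve-∀
  p≤w-z : + p ℤ.≤ w ℤ.- z
  p≤w-z = subst (ℤ._≤ w ℤ.- z) (shift z (+ p)) (ℤ.+-monoˡ-≤ (ℤ.- z) start≤w)
  w-z<p+L : w ℤ.- z ℤ.< + (p + L)
  w-z<p+L = subst (w ℤ.- z ℤ.<_) (shift z (+ (p + L))) (ℤ.+-monoˡ-< (ℤ.- z) w<end)
  +∣w-z∣≡w-z : + ℤ.∣ w ℤ.- z ∣ ≡ w ℤ.- z
  +∣w-z∣≡w-z = ℤ.0≤i⇒+∣i∣≡i (ℤ.≤-trans (ℤ.+≤+ z≤n) p≤w-z)

bounded-steps⇒hit : ∀ (α : ℕ → ℤ) L {n} → (∀ m → m < n → α (suc m) ℤ.- α m ℤ.≤ L) →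
  ∀ u → α 0 ℤ.< u ℤ.+ L → u ℤ.≤ α n → ∃[ m ] u ℤ.≤ α m × α m ℤ.< u ℤ.+ L
bounded-steps⇒hit α L {zero}  _    u α0<u+L u≤α0 = 0 , u≤α0 , α0<u+L
bounded-steps⇒hit α L {suc n} step u α0<u+L u≤α[1+n] with u ℤ.≤? α n
... | yes u≤αn = bounded-steps⇒hit α L (λ m m<n → step m (m<n⇒m<1+n m<n)) u α0<u+L u≤αn
... | no  u≰αn = suc n , u≤α[1+n] ,
  ℤ.≤-<-trans (i-j≤k⇒i≤j+k _ _ _ (step n ≤-refl)) (ℤ.+-monoˡ-< L (ℤ.≰⇒> u≰αn))

halved-steps⇒growth : ∀ (α : ℕ → ℤ) d {n} → (∀ m → m < n → + d ℤ.≤ + 2 ℤ.* (α (suc m) ℤ.- α m)) →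
  + (n * d) ℤ.+ (α 0 ℤ.+ α 0) ℤ.≤ α n ℤ.+ α n
halved-steps⇒growth α d {zero}  _    = ℤ.≤-reflexive (ℤ.+-identityˡ _)
halved-steps⇒growth α d {suc n} step = begin
  + (d + n * d) ℤ.+ (α 0 ℤ.+ α 0)                ≡⟨ cong (ℤ._+ (α 0 ℤ.+ α 0)) (ℤ.pos-+ d (n * d)) ⟩
  (+ d ℤ.+ + (n * d)) ℤ.+ (α 0 ℤ.+ α 0)          ≡⟨ ℤ.+-assoc (+ d) (+ (n * d)) (α 0 ℤ.+ α 0) ⟩
  + d ℤ.+ (+ (n * d) ℤ.+ (α 0 ℤ.+ α 0))          ≤⟨ ℤ.+-mono-≤ (step n ≤-refl) growth ⟩
  + 2 ℤ.* (α (suc n) ℤ.- α n) ℤ.+ (α n ℤ.+ α n) ≡⟨ double (α (suc n)) (α n) ⟩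
  α (suc n) ℤ.+ α (suc n)                        ∎
  where
  open ℤ.≤-Reasoning
  growth = halved-steps⇒growth α d (λ m m<n → step m (m<n⇒m<1+n m<n))
  double : ∀ x y → + 2 ℤ.* (x ℤ.- y) ℤ.+ (y ℤ.+ y) ≡ x ℤ.+ x
  double = ℤ-Solver.solve-∀

halved-steps⇒reach : ∀ (α : ℕ → ℤ) d {n} S → (∀ m → m < n → + d ℤ.≤ + 2 ℤ.* (α (suc m) ℤ.- α m)) →
  S + S ≤ n * d → α 0 ℤ.+ + S ℤ.≤ α n
halved-steps⇒reach α d {n} S step 2S≤nd = i+i≤j+j⇒i≤j (begin
  (α 0 ℤ.+ + S) ℤ.+ (α 0 ℤ.+ + S) ≡⟨ regroup (α 0) (+ S) ⟩
  (+ S ℤ.+ + S) ℤ.+ (α 0 ℤ.+ α 0) ≡⟨ cong (ℤ._+ (α 0 ℤ.+ α 0)) (sym (ℤ.pos-+ S S)) ⟩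
  + (S + S) ℤ.+ (α 0 ℤ.+ α 0)     ≤⟨ ℤ.+-monoˡ-≤ (α 0 ℤ.+ α 0) (ℤ.+≤+ 2S≤nd) ⟩
  + (n * d) ℤ.+ (α 0 ℤ.+ α 0)     ≤⟨ halved-steps⇒growth α d step ⟩
  α n ℤ.+ α n                     ∎)
  where
  open ℤ.≤-Reasoning
  regroup : ∀ a x → (a ℤ.+ x) ℤ.+ (a ℤ.+ x) ≡ (x ℤ.+ x) ℤ.+ (a ℤ.+ a)
  regroup = ℤ-Solver.solve-∀

windowStart-twice≤ : ∀ d {n k i} → i < k → 12 * (k * k) ≤ n →
  windowStart (2 * d) i + windowStart (2 * d) i ≤ n * d
windowStart-twice≤ d {n} {k} {i} i<k 12k²≤n = begin
  S + S                             ≤⟨ +-mono-≤ (m≤m+n S L) (m≤m+n S L) ⟩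
  (S + L) + (S + L)                 ≤⟨ +-mono-≤ (windowEnd≤ L i<k) (windowEnd≤ L i<k) ⟩
  3 * (k * k) * L + 3 * (k * k) * L ≡⟨ twelve d (k * k) ⟩
  12 * (k * k) * d                  ≤⟨ *-monoˡ-≤ d 12k²≤n ⟩
  n * d                             ∎
  where
  open ≤-Reasoning
  twelve : ∀ d x → 3 * x * (2 * d) + 3 * x * (2 * d) ≡ 12 * x * d
  twelve = solve-∀
  L = 2 * d
  S = windowStart L i

doubling-gaps⇒windows : ∀ (α : ℕ → ℤ) d n k → 1 ≤ d →
  (∀ m → m < n → α (suc m) ℤ.- α m ℤ.≤ + (2 * d)) →
  (∀ m → m < n → + d ℤ.≤ + 2 ℤ.* (α (suc m) ℤ.- α m)) →
  12 * (k * k) ≤ n →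
  ∀ i → i < k → ∃[ v ] InWindow (2 * d) i v × ∃[ m ] α m ≡ α 0 ℤ.+ + v
doubling-gaps⇒windows α d n k 1≤d step≤ step≥ 12k²≤n i i<k =
  let m , start≤αm , αm<end = bounded-steps⇒hit α (+ L) step≤ u α0<u+L
                                (halved-steps⇒reach α d S step≥ (windowStart-twice≤ d i<k 12k²≤n))
      v , αm≡α0+v , S≤v , v<S+L = window-offset (α 0) S L (α m) start≤αm (subst (α m ℤ.<_) u+L≡ αm<end)
  in v , (S≤v , v<S+L) , m , αm≡α0+v
  where
  L = 2 * d
  S = windowStart L i
  u = α 0 ℤ.+ + S
  u+L≡ : u ℤ.+ + L ≡ α 0 ℤ.+ + (S + L)
  u+L≡ = trans (ℤ.+-assoc (α 0) (+ S) (+ L)) (cong (ℤ._+_ (α 0)) (sym (ℤ.pos-+ S L)))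
  α0<u+L : α 0 ℤ.< u ℤ.+ + L
  α0<u+L = subst₂ ℤ._<_ (ℤ.+-identityʳ (α 0)) (sym u+L≡)
    (ℤ.+-monoʳ-< (α 0) (+<+ (≤-trans (≤-trans 1≤d (m≤m+n d (d + 0))) (m≤n+m L S))))

regular-gap-bound : ∀ L {n} (a : Seq (suc n)) → Regular (toℚ (+ L)) a →
                    ∀ i j → diff a i ℤ.≤ + L ℤ.* diff a j
regular-gap-bound L a (_ , X , _ , bounds) i j = toℚ-cancel-≤ (begin
  toℚ (diff a i)               ≤⟨ proj₂ (bounds i) ⟩
  toℚ (+ L) ℚ.* X              ≤⟨ ℚ.*-monoˡ-≤-nonNeg (toℚ (+ L)) {{toℚ-nonNegative L}} (proj₁ (bounds j)) ⟩
  toℚ (+ L) ℚ.* toℚ (diff a j) ≡⟨ toℚ-* (+ L) (diff a j) ⟩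
  toℚ (+ L ℤ.* diff a j)       ∎)
  where open ℚ.≤-Reasoning

clamp : ∀ n → ℕ → Fin (suc n)
clamp n       zero    = Fin.zero
clamp zero    (suc m) = Fin.zero
clamp (suc n) (suc m) = Fin.suc (clamp n m)

clamp-toℕ : ∀ n (j : Fin (suc n)) → clamp n (toℕ j) ≡ j
clamp-toℕ n       Fin.zero    = refl
clamp-toℕ (suc n) (Fin.suc j) = cong Fin.suc (clamp-toℕ n j)

diff-clamp : ∀ {n} (a : Seq (suc n)) i → diff a i ≡ a (clamp n (suc (toℕ i))) ℤ.- a (clamp n (toℕ i))
diff-clamp {n} a i = cong₂ ℤ._-_
  (cong a (sym (clamp-toℕ n (Fin.suc i))))
  (cong a (sym (trans (cong (clamp n) (sym (toℕ-inject₁ i))) (clamp-toℕ n (inject₁ i)))))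

i<j⇒0<j-i : ∀ {i j} → i ℤ.< j → + 0 ℤ.< j ℤ.- i
i<j⇒0<j-i {i} {j} i<j = subst (ℤ._< j ℤ.- i) (ℤ.+-inverseʳ i) (ℤ.+-monoˡ-< (ℤ.- i) i<j)

0<i⇒i≡+n : ∀ {x} → + 0 ℤ.< x → ∃[ d ] 1 ≤ d × x ≡ + d
0<i⇒i≡+n {+ suc d}   _        = suc d , s≤s z≤n , refl
0<i⇒i≡+n {+ zero}    (+<+ ())
0<i⇒i≡+n { -[1+ _ ]} ()

regular⇒CAtLeast : ∀ A k → RAtLeast (toℚ (+ 2)) A (16 * (k * k)) → CAtLeast A k
regular⇒CAtLeast A zero    _ = CAtLeast-zero A
regular⇒CAtLeast A (suc k) (zero , 16k²≤0 , _) =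
  ⊥-elim (<⇒≱ (m≤m*n 16 (suc k * suc k)) (≤-trans 16k²≤0 z≤n))
regular⇒CAtLeast A (suc k) (suc zero , 16k²≤1 , _) =
  ⊥-elim (<⇒≱ (m≤m*n 16 (suc k * suc k)) (≤-trans 16k²≤1 (s≤s z≤n)))
regular⇒CAtLeast A (suc k) (suc (suc n) , 16k²≤2+n , a , a∈A , regular) =
  windows⇒CAtLeast A (α 0) (2 * d) (suc k) (≤-trans 1≤d (m≤m+n d (d + 0))) hits
  where
  α : ℕ → ℤ
  α m = a (clamp (suc n) m)
  gap≡diff : ∀ {m} (m<1+n : m < suc n) → α (suc m) ℤ.- α m ≡ diff a (fromℕ< m<1+n)
  gap≡diff m<1+n rewrite diff-clamp a (fromℕ< m<1+n) | toℕ-fromℕ< m<1+n = refl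
  gap-bound : ∀ i j → diff a i ℤ.≤ + 2 ℤ.* diff a j
  gap-bound = regular-gap-bound 2 a regular
  first-gap = 0<i⇒i≡+n (i<j⇒0<j-i (proj₁ regular Fin.zero))
  d = proj₁ first-gap
  1≤d = proj₁ (proj₂ first-gap)
  diff₀≡d : diff a Fin.zero ≡ + d
  diff₀≡d = proj₂ (proj₂ first-gap)
  12k²≤1+n : 12 * (suc k * suc k) ≤ suc n
  12k²≤1+n = ℕ.s≤s⁻¹ (<-≤-trans (*-monoˡ-< (suc k * suc k) (toWitness {a? = 12 ℕ.<? 16} tt)) 16k²≤2+n)
  step≤ : ∀ m → m < suc n → α (suc m) ℤ.- α m ℤ.≤ + (2 * d)
  step≤ m m<1+n = subst₂ ℤ._≤_ (sym (gap≡diff m<1+n))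
    (trans (cong (ℤ._*_ (+ 2)) diff₀≡d) (sym (ℤ.pos-* 2 d))) (gap-bound (fromℕ< m<1+n) Fin.zero)
  step≥ : ∀ m → m < suc n → + d ℤ.≤ + 2 ℤ.* (α (suc m) ℤ.- α m)
  step≥ m m<1+n = subst₂ ℤ._≤_ diff₀≡d (cong (ℤ._*_ (+ 2)) (sym (gap≡diff m<1+n)))
    (gap-bound Fin.zero (fromℕ< m<1+n))
  hits : ∀ i → i < suc k → ∃[ v ] InWindow (2 * d) i v × A (α 0 ℤ.+ + v)
  hits i i<k =
    let (v , window , m , αm≡α0+v) = doubling-gaps⇒windows α d (suc n) (suc k) 1≤d step≤ step≥ 12k²≤1+n i i<k
    in v , window , subst A αm≡α0+v (a∈A (clamp (suc n) m))

-- Partitions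

toSet? : ∀ {N} (S : Subset N) → Decidable (toSet S)
toSet? S z = any? λ j → (j ∈? S) ×-dec (z ℤ.≟ + suc (toℕ j))

shifted-window : ∀ {x m a b} → x + a ≤ m → m < x + b → a ≤ m ∸ x × m ∸ x < b
shifted-window {x} {m} {a} {b} x+a≤m m<x+b =
  +-cancelˡ-≤ x a (m ∸ x) (subst (x + a ≤_) (sym x+[m∸x]≡m) x+a≤m) ,
  +-cancelˡ-< x (m ∸ x) b (subst (_< x + b) (sym x+[m∸x]≡m) m<x+b)
  where
  x+[m∸x]≡m : x + (m ∸ x) ≡ m
  x+[m∸x]≡m = m+[n∸m]≡n (≤-trans (m≤m+n x a) x+a≤m)

colouring⇒CAtLeast : ∀ {k} t → 1 ≤ k → (B : Fin t → ℤ → Set) → (∀ q → Decidable (B q)) →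
  ∀ x M → (3 * (k * k)) ^ t ≤ M → (∀ m → x ≤ m → m < x + M → ∃[ q ] B q (+ m)) →
  ∃[ q ] CAtLeast (B q) k
colouring⇒CAtLeast zero 1≤k B B? x M 1≤M covered with covered x ≤-refl (m<m+n x 1≤M)
... | () , _
colouring⇒CAtLeast {k} (suc t) 1≤k B B? x M K^[1+t]≤M covered
  with all-or-counterexample hit? k
  where
  L = (3 * (k * k)) ^ t
  hit? : Decidable (λ i → ∃[ v ] v < windowStart L i + L × windowStart L i ≤ v × B Fin.zero (+ x ℤ.+ + v))
  hit? i = anyUpTo? (λ v → (windowStart L i ℕ.≤? v) ×-dec B? Fin.zero (+ x ℤ.+ + v)) (windowStart L i + L)
... | inj₁ hits = Fin.zero , windows⇒CAtLeast (B Fin.zero) (+ x) L k 1≤L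
  (λ i i<k → let (v , v<end , start≤v , b) = hits i i<k in v , (start≤v , v<end) , b)
  where
  L = (3 * (k * k)) ^ t
  1≤L = m^n>0 (3 * (k * k)) {{m*n≢0 3 (k * k) {{_}} {{m*n≢0 k k {{k≢0}} {{k≢0}}}}}} t
    where k≢0 = ℕ.>-nonZero 1≤k
... | inj₂ (i , i<k , missed) with colouring⇒CAtLeast t 1≤k (B ∘ Fin.suc) (B? ∘ Fin.suc)
  (x + windowStart L i) L ≤-refl covered′
  where
  L = (3 * (k * k)) ^ t
  end≤ : x + windowStart L i + L ≤ x + M
  end≤ = ≤-trans (≤-reflexive (+-assoc x (windowStart L i) L))
                 (+-monoʳ-≤ x (≤-trans (windowEnd≤ L i<k) K^[1+t]≤M))
  covered′ : ∀ m → x + windowStart L i ≤ m → m < x + windowStart L i + L → ∃[ q ] B (Fin.suc q) (+ m)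
  covered′ m start≤m m<end with covered m (≤-trans (m≤m+n x _) start≤m) (<-≤-trans m<end end≤)
  ... | Fin.suc q , b = q , b
  ... | Fin.zero  , b = ⊥-elim (missed (m ∸ x , proj₂ window , proj₁ window , subst (B Fin.zero) m≡x+v b))
    where
    window = shifted-window {x} {m} start≤m (subst (m <_) (+-assoc x (windowStart L i) L) m<end)
    m≡x+v : + m ≡ + x ℤ.+ + (m ∸ x)
    m≡x+v = trans (cong +_ (sym (m+[n∸m]≡n (≤-trans (m≤m+n x _) start≤m)))) (ℤ.pos-+ x (m ∸ x))
... | q , C = Fin.suc q , C

^-distribʳ-* : ∀ m n o → (m * n) ^ o ≡ m ^ o * n ^ o
^-distribʳ-* m n zero    = refl
^-distribʳ-* m n (suc o) = trans (cong (m * n *_) (^-distribʳ-* m n o)) (interchange m n (m ^ o) (n ^ o))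
  where
  interchange : ∀ a b c d → a * b * (c * d) ≡ a * c * (b * d)
  interchange = solve-∀

partition⇒CAtLeast : ∀ r N → 1 ≤ r → (P : Fin r → Subset N) → IsPartition P →
  ∀ k → (4 * k) ^ (2 * r) * 3 ^ (r * r) ≤ N → ∃[ i ] CAtLeast (toSet (P i)) k
partition⇒CAtLeast (suc r) N _ P _ zero _ = Fin.zero , CAtLeast-zero (toSet (P Fin.zero))
partition⇒CAtLeast r N 1≤r P partition (suc k) bound =
  colouring⇒CAtLeast r (s≤s z≤n) (toSet ∘ P) (toSet? ∘ P) 1 N K^r≤N covered
  where
  K^r≤N : (3 * (suc k * suc k)) ^ r ≤ N
  K^r≤N = begin
    (3 * (suc k * suc k)) ^ r              ≡⟨ ^-distribʳ-* 3 (suc k * suc k) r ⟩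
    3 ^ r * (suc k * suc k) ^ r            ≤⟨ *-mono-≤ (^-monoʳ-≤ 3 (m≤m*n r r {{ℕ.>-nonZero 1≤r}}))
                                                      (^-monoˡ-≤ r (subst (suc k * suc k ≤_) (sixteen (suc k)) (m≤m+n (suc k * suc k) _))) ⟩
    3 ^ (r * r) * ((4 * suc k) ^ 2) ^ r    ≡⟨ cong (3 ^ (r * r) *_) (^-*-assoc (4 * suc k) 2 r) ⟩
    3 ^ (r * r) * (4 * suc k) ^ (2 * r)    ≡⟨ *-comm (3 ^ (r * r)) _ ⟩
    (4 * suc k) ^ (2 * r) * 3 ^ (r * r)    ≤⟨ bound ⟩
    N                                      ∎
    where
    open ≤-Reasoning
    sixteen : ∀ k → k * k + 15 * (k * k) ≡ 4 * k * (4 * k * 1)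
    sixteen = solve-∀
  covered : ∀ m → 1 ≤ m → m < 1 + N → ∃[ i ] toSet (P i) (+ m)
  covered (suc m) _ (s≤s m<N) with partition (fromℕ< m<N)
  ... | i , m∈Pi , _ = i , fromℕ< m<N , m∈Pi , cong (+_ ∘ suc) (sym (toℕ-fromℕ< m<N))

-- Counting and density increments

count : ∀ {P : ℕ → Set} → Decidable P → ℕ → ℕ → ℕ
count P? x zero    = 0
count P? x (suc M) = (if does (P? x) then 1 else 0) + count P? (suc x) M

module _ {P : ℕ → Set} (P? : Decidable P) where

  count-+ : ∀ x M M′ → count P? x (M + M′) ≡ count P? x M + count P? (x + M) M′
  count-+ x zero    M′ = cong (λ y → count P? y M′) (sym (+-identityʳ x))
  count-+ x (suc M) M′ = begin
    ι + count P? (suc x) (M + M′)                           ≡⟨ cong (_+_ ι) (count-+ (suc x) M M′) ⟩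
    ι + (count P? (suc x) M + count P? (suc x + M) M′)      ≡⟨ cong (λ y → ι + (count P? (suc x) M + count P? y M′)) (sym (+-suc x M)) ⟩
    ι + (count P? (suc x) M + count P? (x + suc M) M′)      ≡⟨ sym (+-assoc ι _ _) ⟩
    ι + count P? (suc x) M + count P? (x + suc M) M′        ∎
    where
    open ≡-Reasoning
    ι = if does (P? x) then 1 else 0

  count≤length : ∀ x M → count P? x M ≤ M
  count≤length x zero    = z≤n
  count≤length x (suc M) with does (P? x)
  ... | true  = s≤s (count≤length (suc x) M)
  ... | false = m≤n⇒m≤1+n (count≤length (suc x) M)

  count-mono : ∀ x {M M′} → M ≤ M′ → count P? x M ≤ count P? x M′
  count-mono x {M} {M′} M≤M′ = begin
    count P? x M                                  ≤⟨ m≤m+n _ _ ⟩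
    count P? x M + count P? (x + M) (M′ ∸ M)      ≡⟨ sym (count-+ x M (M′ ∸ M)) ⟩
    count P? x (M + (M′ ∸ M))                     ≡⟨ cong (count P? x) (m+[n∸m]≡n M≤M′) ⟩
    count P? x M′                                 ∎
    where open ≤-Reasoning

  count>0⇒witness : ∀ x M → 0 < count P? x M → ∃[ m ] x ≤ m × m < x + M × P m
  count>0⇒witness x (suc M) count>0 with P? x
  ... | yes Px = x , ≤-refl , m<m+n x z<s , Px
  ... | no  _ with count>0⇒witness (suc x) M count>0
  ...   | m , x<m , m<1+x+M , Pm = m , <⇒≤ x<m , subst (m <_) (sym (+-suc x M)) m<1+x+M , Pm

  count-none : ∀ x M → (∀ m → x ≤ m → m < x + M → ¬ P m) → count P? x M ≡ 0
  count-none x zero    _    = refl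
  count-none x (suc M) none with P? x
  ... | yes Px = ⊥-elim (none x ≤-refl (m<m+n x z<s) Px)
  ... | no  _  = count-none (suc x) M λ m x<m m<1+x+M →
    none m (<⇒≤ x<m) (subst (m <_) (sym (+-suc x M)) m<1+x+M)

count-shift : ∀ {P Q : ℕ → Set} (P? : Decidable P) (Q? : Decidable Q) →
  (∀ m → P (suc m) ⇔ Q m) → ∀ x M → count P? (suc x) M ≡ count Q? x M
count-shift P? Q? P⇔Q x zero    = refl
count-shift P? Q? P⇔Q x (suc M) = cong₂ _+_
  (cong (λ b → if b then 1 else 0) (does-⇔ (P⇔Q x) (P? (suc x)) (Q? x)))
  (count-shift P? Q? P⇔Q (suc x) M)

toSet-∷ : ∀ {N} b (S : Subset N) m → toSet (b ∷ S) (+ suc (suc m)) ⇔ toSet S (+ suc m)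
toSet-∷ b S m = mk⇔ to from
  where
  to : toSet (b ∷ S) (+ suc (suc m)) → toSet S (+ suc m)
  to (Fin.suc j , there j∈S , refl) = j , j∈S , refl
  from : toSet S (+ suc m) → toSet (b ∷ S) (+ suc (suc m))
  from (j , j∈S , refl) = Fin.suc j , there j∈S , refl

count-toSet : ∀ {N} (S : Subset N) → count (toSet? S ∘ +_ ∘ suc) 0 N ≡ ∣ S ∣
count-toSet []      = refl
count-toSet {suc N} (b ∷ S) =
  trans (cong (_+_ (indicator b))
          (trans (count-shift (toSet? (b ∷ S) ∘ +_ ∘ suc) (toSet? S ∘ +_ ∘ suc) (toSet-∷ b S) 0 N) (count-toSet S)))
        (head b)
  where
  indicator : ∀ b → ℕ
  indicator b = if does (toSet? (b ∷ S) (+ 1)) then 1 else 0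
  head : ∀ b → indicator b + ∣ S ∣ ≡ ∣ b ∷ S ∣
  head true  = cong (λ b → (if b then 1 else 0) + ∣ S ∣) (dec-true (toSet? (true ∷ S) (+ 1)) (Fin.zero , here , refl))
  head false = cong (λ b → (if b then 1 else 0) + ∣ S ∣) (dec-false (toSet? (false ∷ S) (+ 1)) λ where
    (Fin.zero  , () , _)
    (Fin.suc _ , _  , ()))

additive-blocks : ∀ (φ : ℕ → ℕ → ℕ) → (∀ z → φ z 0 ≡ 0) →
  (∀ z m n → φ z (m + n) ≡ φ z m + φ (z + m) n) →
  ∀ {W V ℓ} → (∀ y → W * φ y ℓ ≤ V) → ∀ T z → W * φ z (T * ℓ) ≤ T * V
additive-blocks φ φ-0 φ-+ {W} bound zero    z = ≤-reflexive (trans (cong (W *_) (φ-0 z)) (*-zeroʳ W))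
additive-blocks φ φ-0 φ-+ {W} {V} {ℓ} bound (suc T) z = begin
  W * φ z (ℓ + T * ℓ)                      ≡⟨ cong (W *_) (φ-+ z ℓ (T * ℓ)) ⟩
  W * (φ z ℓ + φ (z + ℓ) (T * ℓ))          ≡⟨ *-distribˡ-+ W (φ z ℓ) _ ⟩
  W * φ z ℓ + W * φ (z + ℓ) (T * ℓ)        ≤⟨ +-mono-≤ (bound z) (additive-blocks φ φ-0 φ-+ {W} {V} {ℓ} bound T (z + ℓ)) ⟩
  V + T * V                                ∎
  where open ≤-Reasoning

div-bounds : ∀ u h .{{_ : NonZero h}} → u / h * h ≤ u × u < u / h * h + h
div-bounds u h = m/n*n≤m u h ,
  subst (_< u / h * h + h) (sym (m≡m%n+[m/n]*n u h))
    (subst (u % h + u / h * h <_) (+-comm h (u / h * h)) (+-monoˡ-< (u / h * h) (m%n<n u h)))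

-- Density at least a/E on [x, x + M) cannot coexist with density at most 3a/4E on
-- each of the T ≤ 1 + M/S blocks of length S = 2ch covering it, unless M ≤ 3S.
dense-interval≤three-blocks : ∀ a E C M T c h .{{_ : NonZero a}} →
  a * M ≤ E * C → 2 * E * C ≤ T * (c * (3 * a * h)) → T * (c * h + c * h) ≤ (c * h + c * h) + M →
  M ≤ 3 * (c * h + c * h)
dense-interval≤three-blocks a E C M T c h dense sparse covering = +-cancelˡ-≤ (3 * M) M _ (begin
  3 * M + M                  ≡⟨ solve₁ M ⟩
  2 * (2 * M)                ≤⟨ *-monoʳ-≤ 2 2M≤3Tch ⟩
  2 * (3 * (T * (c * h)))    ≡⟨ solve₂ T (c * h) ⟩
  3 * (T * (c * h + c * h))  ≤⟨ *-monoʳ-≤ 3 covering ⟩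
  3 * ((c * h + c * h) + M)  ≡⟨ solve₃ (c * h + c * h) M ⟩
  3 * M + 3 * (c * h + c * h) ∎)
  where
  open ≤-Reasoning
  solve₁ : ∀ M → 3 * M + M ≡ 2 * (2 * M)
  solve₁ = solve-∀
  solve₂ : ∀ T x → 2 * (3 * (T * x)) ≡ 3 * (T * (x + x))
  solve₂ = solve-∀
  solve₃ : ∀ S M → 3 * (S + M) ≡ 3 * M + 3 * S
  solve₃ = solve-∀
  2M≤3Tch : 2 * M ≤ 3 * (T * (c * h))
  2M≤3Tch = *-cancelˡ-≤ a (begin
    a * (2 * M)                ≡⟨ solve₄ a M ⟩
    2 * (a * M)                ≤⟨ *-monoʳ-≤ 2 dense ⟩
    2 * (E * C)                ≡⟨ sym (*-assoc 2 E C) ⟩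
    2 * E * C                  ≤⟨ sparse ⟩
    T * (c * (3 * a * h))      ≡⟨ solve₅ T c a h ⟩
    a * (3 * (T * (c * h)))    ∎)
    where
    solve₄ : ∀ a M → a * (2 * M) ≡ 2 * (a * M)
    solve₄ = solve-∀
    solve₅ : ∀ T c a h → T * (c * (3 * a * h)) ≡ a * (3 * (T * (c * h)))
    solve₅ = solve-∀

separationFactor : ∀ h .{{_ : NonZero h}} → ℕ → ℕ
separationFactor h i = 2 + windowStart (3 * h) i / h

separated-blocks<interval : ∀ {h k i M} .{{_ : NonZero h}} → 1 ≤ k → i < k → h * (100 * (k * k)) ≤ M →
  3 * (separationFactor h i * h + separationFactor h i * h) < M
separated-blocks<interval {h} {k} {i} {M} 1≤k i<k bound = begin-strict
  3 * (separationFactor h i * h + separationFactor h i * h) ≤⟨ *-monoʳ-≤ 3 (+-mono-≤ [2+q]h≤11hk² [2+q]h≤11hk²) ⟩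
  3 * (11 * hk² + 11 * hk²)          ≡⟨ solve₁ hk² ⟩
  66 * hk²                           <⟨ *-monoˡ-< hk² {{hk²≢0}} (toWitness {a? = 66 ℕ.<? 100} tt) ⟩
  100 * hk²                          ≡⟨ solve₂ h (k * k) ⟩
  h * (100 * (k * k))                ≤⟨ bound ⟩
  M                                  ∎
  where
  open ≤-Reasoning
  solve₁ : ∀ x → 3 * (11 * x + 11 * x) ≡ 66 * x
  solve₁ = solve-∀
  solve₂ : ∀ h x → 100 * (h * x) ≡ h * (100 * x)
  solve₂ = solve-∀
  solve₃ : ∀ h x → 3 * x * (3 * h) ≡ 9 * (h * x)
  solve₃ = solve-∀
  solve₄ : ∀ x → 2 * x + 9 * x ≡ 11 * x
  solve₄ = solve-∀
  u = windowStart (3 * h) i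
  q = u / h
  hk² = h * (k * k)
  h≤hk² : h ≤ hk²
  h≤hk² = m≤m*n h (k * k) {{ℕ.>-nonZero (*-mono-≤ 1≤k 1≤k)}}
  hk²≢0 : NonZero hk²
  hk²≢0 = ℕ.>-nonZero (≤-trans (ℕ.>-nonZero⁻¹ h) h≤hk²)
  u≤9hk² : u ≤ 9 * hk²
  u≤9hk² = ≤-trans (m≤m+n u (3 * h)) (≤-trans (windowEnd≤ (3 * h) i<k) (≤-reflexive (solve₃ h (k * k))))
  [2+q]h≤11hk² : (2 + q) * h ≤ 11 * hk²
  [2+q]h≤11hk² = begin
    (2 + q) * h       ≡⟨ *-distribʳ-+ h 2 q ⟩
    2 * h + q * h     ≤⟨ +-mono-≤ (*-monoʳ-≤ 2 h≤hk²) (≤-trans (proj₁ (div-bounds u h)) u≤9hk²) ⟩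
    2 * hk² + 9 * hk² ≡⟨ solve₄ hk² ⟩
    11 * hk²          ∎

module DensityIncrement
  {B : ℕ → Set} (B? : Decidable B) {N : ℕ} (B<N : ∀ {m} → B m → m < N)
  (D : ℤ → Set) (difference : ∀ {a b} → B a → B b → b ≤ a → D (+ (a ∸ b)))
  {k : ℕ} (1≤k : 1 ≤ k) (e Z : ℕ) .{{_ : NonZero Z}} (100k²≤Z : 100 * (k * k) ≤ Z)
  where

  Hit : ℕ → ℕ → Set
  Hit L i = ∃[ a ] a < N × ∃[ b ] b < N × B a × B b × b ≤ a × InWindow L i (a ∸ b)

  hit? : ∀ L → Decidable (Hit L)
  hit? L i = anyUpTo? (λ a → anyUpTo? (λ b → B? a ×-dec B? b ×-dec b ℕ.≤? a ×-dec
    windowStart L i ℕ.≤? a ∸ b ×-dec a ∸ b ℕ.<? windowStart L i + L) N) N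

  hits⇒CAtLeast : ∀ {L} → 1 ≤ L → (∀ i → i < k → Hit L i) → CAtLeast D k
  hits⇒CAtLeast {L} 1≤L hits = windows⇒CAtLeast D (+ 0) L k 1≤L λ i i<k →
    let (a , _ , b , _ , Ba , Bb , b≤a , window) = hits i i<k in
    a ∸ b , window , subst D (sym (ℤ.+-identityˡ _)) (difference Ba Bb b≤a)

  -- Points of two blocks of length h at distance (2 + ⌊u/h⌋)h differ by an
  -- amount in [u, u + 3h), u = windowStart (3h) i.
  missed⇒separated : ∀ {h i} .{{_ : NonZero h}} → ¬ Hit (3 * h) i → ∀ y →
    count B? y h ≡ 0 ⊎ count B? (y + separationFactor h i * h) h ≡ 0
  missed⇒separated {h} {i} missed y
    with count B? y h ℕ.≟ 0 | count B? (y + separationFactor h i * h) h ℕ.≟ 0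
  ... | yes empty | _         = inj₁ empty
  ... | no  _     | yes empty = inj₂ empty
  ... | no  b≢0   | no  a≢0   = ⊥-elim (missed (a , B<N Ba , b , B<N Bb , Ba , Bb , b≤a , u≤a-b , a-b<u+3h))
    where
    u = windowStart (3 * h) i
    q = u / h
    qh≤u = proj₁ (div-bounds u h)
    u<qh+h = proj₂ (div-bounds u h)
    in-first = count>0⇒witness B? y h (n≢0⇒n>0 b≢0)
    in-second = count>0⇒witness B? (y + (2 + q) * h) h (n≢0⇒n>0 a≢0)
    b = proj₁ in-first
    Bb = proj₂ (proj₂ (proj₂ in-first))
    a = proj₁ in-second
    Ba = proj₂ (proj₂ (proj₂ in-second))
    u+b<a : u + b < a
    u+b<a = begin-strict
      u + b                   <⟨ +-mono-<-≤ u<qh+h (<⇒≤ (proj₁ (proj₂ (proj₂ in-first)))) ⟩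
      q * h + h + (y + h)     ≡⟨ solve₁ q h y ⟩
      y + (2 + q) * h         ≤⟨ proj₁ (proj₂ in-second) ⟩
      a                       ∎
      where
      open ≤-Reasoning
      solve₁ : ∀ q h y → q * h + h + (y + h) ≡ y + (2 + q) * h
      solve₁ = solve-∀
    b≤a = ≤-trans (m≤n+m b u) (<⇒≤ u+b<a)
    u≤a-b = m+n≤o⇒m≤o∸n u (<⇒≤ u+b<a)
    a<b+[u+3h] : a < b + (u + 3 * h)
    a<b+[u+3h] = begin-strict
      a                       <⟨ proj₁ (proj₂ (proj₂ in-second)) ⟩
      y + (2 + q) * h + h     ≡⟨ solve₂ y q h ⟩
      y + (q * h + 3 * h)     ≤⟨ +-mono-≤ (proj₁ (proj₂ in-first)) (+-monoˡ-≤ (3 * h) qh≤u) ⟩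
      b + (u + 3 * h)         ∎
      where
      open ≤-Reasoning
      solve₂ : ∀ y q h → y + (2 + q) * h + h ≡ y + (q * h + 3 * h)
      solve₂ = solve-∀
    a-b<u+3h = +-cancelˡ-< b (a ∸ b) (u + 3 * h) (subst (_< b + (u + 3 * h)) (sym (m+[n∸m]≡n b≤a)) a<b+[u+3h])

  separated⇒sparse-interval : ∀ {h i W V} .{{_ : NonZero h}} → ¬ Hit (3 * h) i →
    (∀ y → W * count B? y h ≤ V) → ∀ T x →
    W * count B? x (T * (separationFactor h i * h + separationFactor h i * h)) ≤ T * (separationFactor h i * V)
  separated⇒sparse-interval {h} {i} {W} {V} missed sparse =
    additive-blocks (count B?) (λ _ → refl) (count-+ B?) {W} {c * V} {s + s} double-blocks-sparse
    where
    c = separationFactor h i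
    s = c * h
    ψ : ℕ → ℕ → ℕ
    ψ z M = count B? z M + count B? (z + s) M
    ψ-+ : ∀ z m n → ψ z (m + n) ≡ ψ z m + ψ (z + m) n
    ψ-+ z m n = trans (cong₂ _+_ (count-+ B? z m n) (count-+ B? (z + s) m n))
      (trans (cong (λ y → (count B? z m + count B? (z + m) n) + (count B? (z + s) m + count B? y n)) (swap z s m))
             (interchange (count B? z m) (count B? (z + m) n) (count B? (z + s) m) (count B? (z + m + s) n)))
      where
      swap : ∀ z s m → z + s + m ≡ z + m + s
      swap = solve-∀
      interchange : ∀ a b c d → (a + b) + (c + d) ≡ (a + c) + (b + d)
      interchange = solve-∀
    pair-sparse : ∀ y → W * ψ y h ≤ V
    pair-sparse y with missed⇒separated {h} {i} missed y
    ... | inj₁ empty rewrite empty                              = sparse (y + s)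
    ... | inj₂ empty rewrite empty | +-identityʳ (count B? y h) = sparse y
    double-blocks-sparse : ∀ z → W * count B? z (s + s) ≤ c * V
    double-blocks-sparse z = subst (λ n → W * n ≤ c * V) (sym (count-+ B? z s s))
      (additive-blocks ψ (λ _ → refl) ψ-+ {W} {V} {h} pair-sparse c z)

  denser-block : ∀ {j x M h i} .{{_ : NonZero h}} → h * Z ≤ M → i < k → ¬ Hit (3 * h) i →
    3 ^ j * M ≤ 2 ^ (e + j) * count B? x M →
    ∃[ y ] 3 ^ suc j * h ≤ 2 ^ (e + suc j) * count B? y h
  denser-block {j} {x} {M} {h} {i} hZ≤M i<k missed dense
    with anyUpTo? (λ y → 3 ^ suc j * h ℕ.≤? 2 ^ (e + suc j) * count B? y h) N
  ... | yes (y , _ , denser) = y , denser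
  ... | no  none = ⊥-elim (<⇒≱ (separated-blocks<interval 1≤k i<k large) M≤3S)
    where
    c = separationFactor h i
    S = c * h + c * h
    W = 2 ^ (e + suc j)
    V = 3 ^ suc j * h
    large : h * (100 * (k * k)) ≤ M
    large = ≤-trans (*-monoʳ-≤ h 100k²≤Z) hZ≤M
    sparse : ∀ y → W * count B? y h ≤ V
    sparse y with y ℕ.<? N
    ... | yes y<N = <⇒≤ (≰⇒> λ denser → none (y , y<N , denser))
    ... | no  y≮N = subst (_≤ V) (sym (trans (cong (W *_) empty) (*-zeroʳ W))) z≤n
      where
      empty = count-none B? y h λ m y≤m _ Bm → y≮N (≤-<-trans y≤m (B<N Bm))
    instance
      S≢0 : NonZero S
      S≢0 = ℕ.>-nonZero (≤-trans (ℕ.>-nonZero⁻¹ h) (≤-trans (m≤m+n h _) (m≤m+n (c * h) (c * h))))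
    T = suc (M / S)
    M<TS : M < T * S
    M<TS = subst (M <_) (+-comm (M / S * S) S) (proj₂ (div-bounds M S))
    covering : T * S ≤ S + M
    covering = +-monoʳ-≤ S (m/n*n≤m M S)
    sparse-interval : 2 * 2 ^ (e + j) * count B? x M ≤ T * (c * (3 * 3 ^ j * h))
    sparse-interval = begin
      2 * 2 ^ (e + j) * count B? x M ≡⟨ cong (λ n → 2 ^ n * count B? x M) (sym (+-suc e j)) ⟩
      W * count B? x M               ≤⟨ *-monoʳ-≤ W (count-mono B? x (<⇒≤ M<TS)) ⟩
      W * count B? x (T * S)         ≤⟨ separated⇒sparse-interval {h} {i} {W} {V} missed sparse T x ⟩
      T * (c * V)                    ∎
      where open ≤-Reasoning
    M≤3S : M ≤ 3 * S
    M≤3S = dense-interval≤three-blocks (3 ^ j) (2 ^ (e + j)) (count B? x M) M T c h {{m^n≢0 3 j}}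
      dense sparse-interval covering

  Z^f≤M/Z : ∀ f {M} → Z ^ suc f ≤ M → Z ^ f ≤ M / Z
  Z^f≤M/Z f {M} Z^[1+f]≤M =
    subst (_≤ M / Z) (m*n/n≡m (Z ^ f) Z) (/-monoˡ-≤ Z (subst (_≤ M) (*-comm Z (Z ^ f)) Z^[1+f]≤M))

  -- Invariant: B has density at least (3/2)^j / 2^e on [x, x + M).
  dense⇒CAtLeast : ∀ f j x M → Z ^ f ≤ M → 3 ^ j * M ≤ 2 ^ (e + j) * count B? x M →
                   2 ^ (e + j + f) < 3 ^ (j + f) → CAtLeast D k
  dense⇒CAtLeast zero j x M 1≤M dense 2^<3^ = ⊥-elim (<⇒≱ too-dense dense)
    where
    too-dense : 2 ^ (e + j) * count B? x M < 3 ^ j * M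
    too-dense = ≤-<-trans (*-monoʳ-≤ (2 ^ (e + j)) (count≤length B? x M))
      (*-monoˡ-< M {{ℕ.>-nonZero 1≤M}} (subst₂ (λ a b → 2 ^ a < 3 ^ b) (+-identityʳ (e + j)) (+-identityʳ j) 2^<3^))
  dense⇒CAtLeast (suc f) j x M Z^[1+f]≤M dense 2^<3^
    with all-or-counterexample (hit? (3 * (M / Z))) k
  ... | inj₁ hits = hits⇒CAtLeast (≤-trans 1≤h (m≤n*m h 3)) hits
    where
    h = M / Z
    1≤h = ≤-trans (m^n>0 Z f) (Z^f≤M/Z f Z^[1+f]≤M)
  ... | inj₂ (i , i<k , missed) =
    dense⇒CAtLeast f (suc j) (proj₁ denser) h (Z^f≤M/Z f Z^[1+f]≤M) (proj₂ denser) 2^<3^′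
    where
    h = M / Z
    instance
      h≢0 : NonZero h
      h≢0 = ℕ.>-nonZero (≤-trans (m^n>0 Z f) (Z^f≤M/Z f Z^[1+f]≤M))
    denser = denser-block {j} {x} {M} {h} {i} (m/n*n≤m M Z) i<k missed dense
    2^<3^′ : 2 ^ (e + suc j + f) < 3 ^ (suc j + f)
    2^<3^′ = subst₂ (λ a b → 2 ^ a < 3 ^ b)
      (trans (+-suc (e + j) f) (cong (_+ f) (sym (+-suc e j)))) (+-suc j f) 2^<3^

-- Difference sets of dense sets

density⇒card≥ : ∀ c δ N m → 1ℚ ℚ.≤ toℚ (+ c) ℚ.* δ → δ ℚ.* toℚ (+ N) ℚ.≤ toℚ (+ m) → N ≤ c * m
density⇒card≥ c δ N m 1≤cδ δN≤m = ℤ.drop‿+≤+ (toℚ-cancel-≤ (begin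
  toℚ (+ N)                          ≡⟨ sym (ℚ.*-identityˡ (toℚ (+ N))) ⟩
  1ℚ ℚ.* toℚ (+ N)                   ≤⟨ ℚ.*-monoʳ-≤-nonNeg (toℚ (+ N)) {{toℚ-nonNegative N}} 1≤cδ ⟩
  toℚ (+ c) ℚ.* δ ℚ.* toℚ (+ N)      ≡⟨ ℚ.*-assoc (toℚ (+ c)) δ (toℚ (+ N)) ⟩
  toℚ (+ c) ℚ.* (δ ℚ.* toℚ (+ N))    ≤⟨ ℚ.*-monoˡ-≤-nonNeg (toℚ (+ c)) {{toℚ-nonNegative c}} δN≤m ⟩
  toℚ (+ c) ℚ.* toℚ (+ m)            ≡⟨ toℚ-* (+ c) (+ m) ⟩
  toℚ (+ c ℤ.* + m)                  ≡⟨ cong toℚ (sym (ℤ.pos-* c m)) ⟩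
  toℚ (+ (c * m))                    ∎))
  where open ℚ.≤-Reasoning

[100k²]^[2s+4]≤N : ∀ k s N → (4 * 3 ^ 8 * suc k) ^ (16 * s + 16) ≤ N → (100 * (suc k * suc k)) ^ (2 * s + 4) ≤ N
[100k²]^[2s+4]≤N k s N X^[16s+16]≤N = begin
  (100 * (suc k * suc k)) ^ (2 * s + 4) ≤⟨ ^-monoˡ-≤ (2 * s + 4) 100k²≤X² ⟩
  (X ^ 2) ^ (2 * s + 4)                 ≡⟨ ^-*-assoc X 2 (2 * s + 4) ⟩
  X ^ (2 * (2 * s + 4))                 ≤⟨ ^-monoʳ-≤ X {{ℕ.>-nonZero (≤-trans (s≤s z≤n) 10k≤X)}} exponent≤ ⟩
  X ^ (16 * s + 16)                     ≤⟨ X^[16s+16]≤N ⟩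
  N                                     ∎
  where
  open ≤-Reasoning
  X = 4 * 3 ^ 8 * suc k
  10k≤X : 10 * suc k ≤ X
  10k≤X = *-monoˡ-≤ (suc k) (toWitness {a? = 10 ℕ.≤? 4 * 3 ^ 8} tt)
  square : ∀ k → 10 * k * (10 * k) ≡ 100 * (k * k)
  square = solve-∀
  exponent : ∀ s → 2 * (2 * s + 4) + (12 * s + 8) ≡ 16 * s + 16
  exponent = solve-∀
  exponent≤ : 2 * (2 * s + 4) ≤ 16 * s + 16
  exponent≤ = subst (2 * (2 * s + 4) ≤_) (exponent s) (m≤m+n _ (12 * s + 8))
  100k²≤X² : 100 * (suc k * suc k) ≤ X ^ 2
  100k²≤X² = subst₂ _≤_ (square (suc k)) (cong (X *_) (sym (*-identityʳ X))) (*-mono-≤ 10k≤X 10k≤X)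

2^[3s+6]<3^[2s+4] : ∀ s → 2 ^ (s + 2 + 0 + (2 * s + 4)) < 3 ^ (0 + (2 * s + 4))
2^[3s+6]<3^[2s+4] s = subst₂ _<_
  (trans (^-*-assoc 2 3 (s + 2)) (cong (2 ^_) (e₁ s)))
  (trans (^-*-assoc 3 2 (s + 2)) (cong (3 ^_) (e₂ s)))
  (^-monoˡ-< (s + 2) {{ℕ.>-nonZero (≤-trans (s≤s z≤n) (m≤n+m 2 s))}} (toWitness {a? = 8 ℕ.<? 9} tt))
  where
  e₁ : ∀ s → 3 * (s + 2) ≡ s + 2 + 0 + (2 * s + 4)
  e₁ = solve-∀
  e₂ : ∀ s → 2 * (s + 2) ≡ 2 * s + 4
  e₂ = solve-∀

dense⇒CAtLeast-DiffSet : ∀ δ s → 1ℚ ℚ.≤ toℚ (+ (2 ^ s * 4)) ℚ.* δ →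
  ∀ N (A : Subset N) → δ ℚ.* toℚ (+ N) ℚ.≤ toℚ (+ ∣ A ∣) →
  ∀ k → (4 * 3 ^ 8 * k) ^ (16 * s + 16) ≤ N → CAtLeast (DiffSet (toSet A)) k
dense⇒CAtLeast-DiffSet δ s 1≤cδ N A δN≤∣A∣ zero    _ = CAtLeast-zero (DiffSet (toSet A))
dense⇒CAtLeast-DiffSet δ s 1≤cδ N A δN≤∣A∣ (suc k) X^[16s+16]≤N =
  dense⇒CAtLeast (2 * s + 4) 0 0 N ([100k²]^[2s+4]≤N k s N X^[16s+16]≤N) initial-density (2^[3s+6]<3^[2s+4] s)
  where
  below : ∀ {m} → toSet A (+ suc m) → m < N
  below (j , _ , refl) = toℕ<n j
  difference : ∀ {a b} → toSet A (+ suc a) → toSet A (+ suc b) → b ≤ a → DiffSet (toSet A) (+ (a ∸ b))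
  difference {a} {b} Aa Ab b≤a =
    + suc a , + suc b , Aa , Ab , sym (trans (ℤ.m-n≡m⊖n (suc a) (suc b)) (ℤ.⊖-≥ (s≤s b≤a)))
  open DensityIncrement (toSet? A ∘ +_ ∘ suc) below (DiffSet (toSet A)) difference {suc k} (s≤s z≤n)
    (s + 2) (100 * (suc k * suc k)) ≤-refl
  initial-density : 3 ^ 0 * N ≤ 2 ^ (s + 2 + 0) * count (toSet? A ∘ +_ ∘ suc) 0 N
  initial-density = subst₂ _≤_ (sym (*-identityˡ N))
    (cong₂ _*_ (trans (sym (^-distribˡ-+-* 2 s 2)) (cong (2 ^_) (sym (+-identityʳ (s + 2))))) (sym (count-toSet A)))
    (density⇒card≥ (2 ^ s * 4) δ N ∣ A ∣ 1≤cδ δN≤∣A∣)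

theorem4 :
    -- (1) C(A) ≥ ⌊ R₂(A)^{1/2} / 4 ⌋  for every set A of integers
    ((A : ℤ → Set) (k : ℕ) → RAtLeast (toℚ (+ 2)) A (16 * (k * k)) → CAtLeast A k)
    ×
    -- (2) partitions of {1,…,N} into r parts
    ((r N : ℕ) → 1 ≤ r → 1 ≤ N → (P : Fin r → Subset N) → IsPartition P →
      3 ^ (r * r + r) ≤ N →
      (k : ℕ) → (4 * k) ^ (2 * r) * 3 ^ (r * r) ≤ N →
      ∃ λ (i : Fin r) → CAtLeast (toSet (P i)) k)
    ×
    -- (3) difference sets of dense subsets of {1,…,N}
    ((δ : ℚ) → 0ℚ ℚ.< δ → δ ℚ.≤ 1ℚ →
      (s : ℕ) → 1ℚ ℚ.≤ toℚ (+ (2 ^ s * 4)) ℚ.* δ → toℚ (+ (2 ^ s * 4)) ℚ.* δ ℚ.< toℚ (+ 2) →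
      (N : ℕ) → 1 ≤ N → ((2 * s) ^ s ⊔ 3 ^ (73 * s)) ≤ N →
      (A : Subset N) → δ ℚ.* toℚ (+ N) ℚ.≤ toℚ (+ ∣ A ∣) →
      (k : ℕ) → (4 * 3 ^ 8 * k) ^ (16 * s + 16) ≤ N →
      CAtLeast (DiffSet (toSet A)) k)
theorem4 =
  regular⇒CAtLeast ,
  (λ r N 1≤r _ P partition _ → partition⇒CAtLeast r N 1≤r P partition) ,
  (λ δ _ _ s 1≤cδ _ N _ _ A δN≤∣A∣ → dense⇒CAtLeast-DiffSet δ s 1≤cδ N A δN≤∣A∣)
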